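{- For every graph $G$ with $n$ vertices and $m$ edges, \[ 2\sum_{u\in V(G)}d(u)\bigl(t'(u)-t(u)\bigr)=4m^{2}-4\sum_{uv\in E(G)}d(u)d(v). \]
   Context: All graphs are finite, simple and undirected. For a vertex $u$, $d(u)$ is its degree, $\Gamma(u)$ its set of neighbors, $t(u)$ the number of triangles of $G$ containing $u$, and $t'(u)$ the number of edges of $G$ with both endpoints in $V(G)\setminus\Gamma(u)$. The sum over $uv\in E(G)$ is over edges, each counted once. -}

module Defs where

open import Data.Nat using (ℕ; zero; suc; _+_; _*_; _<ᵇ_)
open import Data.Bool using (Bool; true; false; if_then_else_; _∧_; not)
import Data.Fin
open import Data.Fin using (Fin; toℕ)
import Data.Integer as ℤ
open import Relation.Binary.PropositionalEquality using (_≡_)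

sumFin : (n : ℕ) → (Fin n → ℕ) → ℕ
sumFin zero    f = 0
sumFin (suc n) f = f Data.Fin.zero + sumFin n (λ i → f (Data.Fin.suc i))

sumFinℤ : (n : ℕ) → (Fin n → ℤ.ℤ) → ℤ.ℤ
sumFinℤ zero    f = ℤ.+ 0
sumFinℤ (suc n) f = f Data.Fin.zero ℤ.+ sumFinℤ n (λ i → f (Data.Fin.suc i))

record Graph (n : ℕ) : Set where
  field
    adj    : Fin n → Fin n → Bool
    sym    : ∀ i j → adj i j ≡ adj j i
    irrefl : ∀ i → adj i i ≡ false
open Graph public

indicator : Bool → ℕ
indicator true  = 1
indicator false = 0

sumPairs : (n : ℕ) → (Fin n → Fin n → Bool) → (Fin n → Fin n → ℕ) → ℕ
sumPairs n p f =
  sumFin n (λ i → sumFin n (λ j →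
    if (toℕ i <ᵇ toℕ j) ∧ p i j then f i j else 0))

module _ {n : ℕ} (G : Graph n) where
  sumEdges : (Fin n → Fin n → ℕ) → ℕ
  sumEdges f = sumPairs n (adj G) f

  numEdges : ℕ
  numEdges = sumEdges (λ _ _ → 1)

  degree : Fin n → ℕ
  degree u = sumFin n (λ v → indicator (adj G u v))

  -- t(u): number of triangles containing u
  -- (edges vw with both v, w neighbours of u)
  triangles : Fin n → ℕ
  triangles u = sumPairs n (λ v w → adj G v w ∧ adj G u v ∧ adj G u w) (λ _ _ → 1)

  -- t'(u): number of edges with both endpoints in V(G) \ Γ(u)
  nonNbrEdges : Fin n → ℕ
  nonNbrEdges u =
    sumPairs n (λ v w → adj G v w ∧ not (adj G u v) ∧ not (adj G u w)) (λ _ _ → 1)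

-- Fix a vertex u and sort each edge vw by how many of its endpoints are
-- neighbours of u. Counting endpoints in Γ(u) over all edges gives
-- Σ_{v ∈ Γ(u)} d(v); an edge avoiding Γ(u) is counted by t′(u) instead, and
-- an edge with both endpoints in Γ(u) is a triangle through u. Hence
-- t′(u) + Σ_{v ∈ Γ(u)} d(v) = m + t(u). Multiplying by d(u) and summing over u,
-- the handshake lemma Σ_u d(u) = 2m and Σ_u d(u) Σ_{v ∈ Γ(u)} d(v) =
-- 2 Σ_{uv ∈ E} d(u) d(v) give the identity.
module Submission where

open import Data.Bool using (Bool; true; false; if_then_else_; _∧_; not)
open import Data.Bool.Properties using (∧-comm)
open import Data.Fin using (Fin; zero; suc; toℕ)
open import Data.Fin.Properties using (toℕ-injective)
open import Data.Nat using (ℕ; zero; suc; _<ᵇ_) renaming (_+_ to _+ℕ_; _*_ to _*ℕ_)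
open import Function using (_∘_)
open import Relation.Binary.PropositionalEquality
  using (_≡_; refl; sym; trans; cong; cong₂; module ≡-Reasoning)
open import Relation.Nullary using (contradiction)
open import Relation.Nullary.Reflects using (ofʸ; ofⁿ)

open import Defs hiding (sym)

module _ where
  open import Data.Nat using (_+_; _*_)
  open import Data.Nat.Properties
    using (+-*-semiring; +-identityʳ; *-cancelˡ-≡; <ᵇ-reflects-<; <-asym; ≤-antisym; ≮⇒≥)
  open import Algebra.Properties.Semiring.Sum +-*-semiring
    using (sum; sum-cong-≗; ∑-distrib-+; ∑-comm; *-distribˡ-sum; *-distribʳ-sum)
  open ≡-Reasoning

  sumFin≡sum : ∀ n (f : Fin n → ℕ) → sumFin n f ≡ sum f
  sumFin≡sum zero    f = refl
  sumFin≡sum (suc n) f = cong (f zero +_) (sumFin≡sum n (f ∘ suc))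

  sumFin-cong : ∀ n {f g : Fin n → ℕ} → (∀ i → f i ≡ g i) → sumFin n f ≡ sumFin n g
  sumFin-cong n {f} {g} f≗g
    rewrite sumFin≡sum n f | sumFin≡sum n g = sum-cong-≗ f≗g

  sumFin-distrib-+ : ∀ n (f g : Fin n → ℕ) →
    sumFin n (λ i → f i + g i) ≡ sumFin n f + sumFin n g
  sumFin-distrib-+ n f g
    rewrite sumFin≡sum n (λ i → f i + g i) | sumFin≡sum n f | sumFin≡sum n g =
      ∑-distrib-+ f g

  *-distribˡ-sumFin : ∀ n c (f : Fin n → ℕ) → c * sumFin n f ≡ sumFin n (λ i → c * f i)
  *-distribˡ-sumFin n c f
    rewrite sumFin≡sum n f | sumFin≡sum n (λ i → c * f i) = *-distribˡ-sum c f

  *-distribʳ-sumFin : ∀ n c (f : Fin n → ℕ) → sumFin n f * c ≡ sumFin n (λ i → f i * c)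
  *-distribʳ-sumFin n c f
    rewrite sumFin≡sum n f | sumFin≡sum n (λ i → f i * c) = *-distribʳ-sum c f

  sumFin-comm : ∀ n m (h : Fin n → Fin m → ℕ) →
    sumFin n (λ i → sumFin m (h i)) ≡ sumFin m (λ j → sumFin n (λ i → h i j))
  sumFin-comm n m h = begin
    sumFin n (λ i → sumFin m (h i))          ≡⟨ nested≡sum n m h ⟩
    sum (λ i → sum (h i))                    ≡⟨ ∑-comm h ⟩
    sum (λ j → sum (λ i → h i j))            ≡⟨ nested≡sum m n (λ j i → h i j) ⟨
    sumFin m (λ j → sumFin n (λ i → h i j))  ∎
    where
    nested≡sum : ∀ k l (g : Fin k → Fin l → ℕ) →
      sumFin k (λ i → sumFin l (g i)) ≡ sum (λ i → sum (g i))
    nested≡sum k l g = trans (sumFin-cong k (λ i → sumFin≡sum l (g i))) (sumFin≡sum k _)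

  sumFin² : ∀ n → (Fin n → Fin n → ℕ) → ℕ
  sumFin² n h = sumFin n (λ i → sumFin n (h i))

  sumFin²-cong : ∀ n {f g : Fin n → Fin n → ℕ} →
    (∀ i j → f i j ≡ g i j) → sumFin² n f ≡ sumFin² n g
  sumFin²-cong n f≗g = sumFin-cong n (λ i → sumFin-cong n (f≗g i))

  sumFin²-distrib-+ : ∀ n (f g : Fin n → Fin n → ℕ) →
    sumFin² n (λ i j → f i j + g i j) ≡ sumFin² n f + sumFin² n g
  sumFin²-distrib-+ n f g =
    trans (sumFin-cong n (λ i → sumFin-distrib-+ n (f i) (g i))) (sumFin-distrib-+ n _ _)

  sumFin²-transpose : ∀ n (h : Fin n → Fin n → ℕ) → sumFin² n h ≡ sumFin² n (λ i j → h j i)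
  sumFin²-transpose n = sumFin-comm n n

  sumPairs-double : ∀ n (p : Fin n → Fin n → Bool) (f : Fin n → Fin n → ℕ) →
    (∀ i j → p i j ≡ p j i) → (∀ i → p i i ≡ false) → (∀ i j → f i j ≡ f j i) →
    sumPairs n p f + sumPairs n p f ≡ sumFin² n (λ i j → if p i j then f i j else 0)
  sumPairs-double n p f p-sym p-irrefl f-sym = begin
    sumFin² n below + sumFin² n below
      ≡⟨ cong (sumFin² n below +_) (sumFin²-transpose n below) ⟩
    sumFin² n below + sumFin² n (λ i j → below j i)
      ≡⟨ sumFin²-distrib-+ n below _ ⟨
    sumFin² n (λ i j → below i j + below j i)
      ≡⟨ sumFin²-cong n below+above ⟩
    sumFin² n (λ i j → if p i j then f i j else 0) ∎
    where
    below : Fin n → Fin n → ℕ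
    below i j = if (toℕ i <ᵇ toℕ j) ∧ p i j then f i j else 0

    below+above : ∀ i j → below i j + below j i ≡ (if p i j then f i j else 0)
    below+above i j
      with toℕ i <ᵇ toℕ j | <ᵇ-reflects-< (toℕ i) (toℕ j)
         | toℕ j <ᵇ toℕ i | <ᵇ-reflects-< (toℕ j) (toℕ i)
    ... | true  | ofʸ i<j | true  | ofʸ j<i = contradiction j<i (<-asym i<j)
    ... | true  | _       | false | _       = +-identityʳ _
    ... | false | _       | true  | _       =
      cong₂ (λ b x → if b then x else 0) (p-sym j i) (f-sym j i)
    ... | false | ofⁿ i≮j | false | ofⁿ j≮i =
      cong (λ b → if b then f i j else 0) (sym p-ij≡false)
      where
      p-ij≡false : p i j ≡ false
      p-ij≡false rewrite toℕ-injective (≤-antisym (≮⇒≥ j≮i) (≮⇒≥ i≮j)) = p-irrefl j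

  sumPairs-count-double : ∀ n (p : Fin n → Fin n → Bool) →
    (∀ i j → p i j ≡ p j i) → (∀ i → p i i ≡ false) →
    sumPairs n p (λ _ _ → 1) + sumPairs n p (λ _ _ → 1)
      ≡ sumFin² n (λ i j → indicator (p i j))
  sumPairs-count-double n p p-sym p-irrefl =
    trans (sumPairs-double n p (λ _ _ → 1) p-sym p-irrefl (λ _ _ → refl))
          (sumFin²-cong n (λ i j → if-1-0≡indicator (p i j)))
    where
    if-1-0≡indicator : ∀ b → (if b then 1 else 0) ≡ indicator b
    if-1-0≡indicator true  = refl
    if-1-0≡indicator false = refl

  +-double-injective : ∀ x y → x + x ≡ y + y → x ≡ y
  +-double-injective x y x+x≡y+y = *-cancelˡ-≡ x y 2 (begin
    2 * x  ≡⟨ cong (x +_) (+-identityʳ x) ⟩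
    x + x  ≡⟨ x+x≡y+y ⟩
    y + y  ≡⟨ cong (y +_) (+-identityʳ y) ⟨
    2 * y  ∎)

  edge-classification : ∀ a b c →
    indicator (a ∧ not b ∧ not c) + (indicator b * indicator a + indicator c * indicator a)
      ≡ indicator a + indicator (a ∧ b ∧ c)
  edge-classification true  true  true  = refl
  edge-classification true  true  false = refl
  edge-classification true  false true  = refl
  edge-classification true  false false = refl
  edge-classification false true  true  = refl
  edge-classification false true  false = refl
  edge-classification false false true  = refl
  edge-classification false false false = refl

module _ {n : ℕ} (G : Graph n) where
  open import Data.Nat using (_+_; _*_)
  open import Data.Nat.Properties
    using (+-commutativeSemigroup; *-comm; *-identityˡ; *-zeroʳ; *-distribˡ-+)
  open import Algebra.Properties.CommutativeSemigroup +-commutativeSemigroup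
    using (interchange)
  open ≡-Reasoning

  neighbourDegreeSum : Fin n → ℕ
  neighbourDegreeSum u = sumFin n (λ v → indicator (adj G u v) * degree G v)

  degreeProductSum : ℕ
  degreeProductSum = sumEdges G (λ u v → degree G u * degree G v)

  numEdges-double : numEdges G + numEdges G ≡ sumFin² n (λ v w → indicator (adj G v w))
  numEdges-double = sumPairs-count-double n (adj G) (Graph.sym G) (irrefl G)

  handshake : sumFin n (degree G) ≡ numEdges G + numEdges G
  handshake = sym numEdges-double

  edgesWithin-double : (q : Fin n → Bool) →
    let p = λ v w → adj G v w ∧ q v ∧ q w in
    sumPairs n p (λ _ _ → 1) + sumPairs n p (λ _ _ → 1) ≡ sumFin² n (λ v w → indicator (p v w))
  edgesWithin-double q = sumPairs-count-double n _
    (λ v w → cong₂ _∧_ (Graph.sym G v w) (∧-comm (q v) (q w)))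
    (λ v → cong (_∧ (q v ∧ q v)) (irrefl G v))

  nonNbrEdges+neighbourDegreeSum≡numEdges+triangles : ∀ u →
    nonNbrEdges G u + neighbourDegreeSum u ≡ numEdges G + triangles G u
  nonNbrEdges+neighbourDegreeSum≡numEdges+triangles u = +-double-injective _ _ (begin
    (t′ + X) + (t′ + X)
      ≡⟨ interchange t′ X t′ X ⟩
    (t′ + t′) + (X + X)
      ≡⟨ cong₂ _+_ (edgesWithin-double (not ∘ adj G u)) X-double ⟩
    sumFin² n avoiding + sumFin² n (λ v w → walk v w + walk w v)
      ≡⟨ sumFin²-distrib-+ n _ _ ⟨
    sumFin² n (λ v w → avoiding v w + (walk v w + walk w v))
      ≡⟨ sumFin²-cong n classify ⟩
    sumFin² n (λ v w → edge v w + inside v w)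
      ≡⟨ sumFin²-distrib-+ n edge inside ⟩
    sumFin² n edge + sumFin² n inside
      ≡⟨ cong₂ _+_ numEdges-double (edgesWithin-double (adj G u)) ⟨
    (m + m) + (t + t)
      ≡⟨ interchange m m t t ⟩
    (m + t) + (m + t) ∎)
    where
    t′ = nonNbrEdges G u
    t = triangles G u
    m = numEdges G
    X = neighbourDegreeSum u

    edge avoiding inside walk : Fin n → Fin n → ℕ
    edge v w = indicator (adj G v w)
    avoiding v w = indicator (adj G v w ∧ not (adj G u v) ∧ not (adj G u w))
    inside v w = indicator (adj G v w ∧ adj G u v ∧ adj G u w)
    walk v w = indicator (adj G u v) * indicator (adj G v w)

    X≡sumFin²-walk : X ≡ sumFin² n walk
    X≡sumFin²-walk = sumFin-cong n (λ v → *-distribˡ-sumFin n (indicator (adj G u v)) _)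

    X-double : X + X ≡ sumFin² n (λ v w → walk v w + walk w v)
    X-double = begin
      X + X
        ≡⟨ cong₂ _+_ X≡sumFin²-walk (trans X≡sumFin²-walk (sumFin²-transpose n walk)) ⟩
      sumFin² n walk + sumFin² n (λ v w → walk w v)
        ≡⟨ sumFin²-distrib-+ n _ _ ⟨
      sumFin² n (λ v w → walk v w + walk w v) ∎

    classify : ∀ v w → avoiding v w + (walk v w + walk w v) ≡ edge v w + inside v w
    classify v w rewrite Graph.sym G w v =
      edge-classification (adj G v w) (adj G u v) (adj G u w)

  ∑degree*neighbourDegreeSum :
    sumFin n (λ u → degree G u * neighbourDegreeSum u) ≡ degreeProductSum + degreeProductSum
  ∑degree*neighbourDegreeSum = begin
    sumFin n (λ u → d u * neighbourDegreeSum u)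
      ≡⟨ sumFin-cong n (λ u → *-distribˡ-sumFin n (d u) _) ⟩
    sumFin² n (λ u v → d u * (indicator (adj G u v) * d v))
      ≡⟨ sumFin²-cong n select ⟩
    sumFin² n (λ u v → if adj G u v then d u * d v else 0)
      ≡⟨ sumPairs-double n (adj G) _ (Graph.sym G) (irrefl G) (λ u v → *-comm (d u) (d v)) ⟨
    degreeProductSum + degreeProductSum ∎
    where
    d = degree G

    select : ∀ u v → d u * (indicator (adj G u v) * d v) ≡ (if adj G u v then d u * d v else 0)
    select u v with adj G u v
    ... | true  = cong (d u *_) (*-identityˡ (d v))
    ... | false = *-zeroʳ (d u)

  degreeWeighted-identity :
    sumFin n (λ u → degree G u * nonNbrEdges G u) + (degreeProductSum + degreeProductSum)
      ≡ (numEdges G + numEdges G) * numEdges G + sumFin n (λ u → degree G u * triangles G u)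
  degreeWeighted-identity = begin
    sumFin n (λ u → d u * t′ u) + (E + E)
      ≡⟨ cong (sumFin n (λ u → d u * t′ u) +_) ∑degree*neighbourDegreeSum ⟨
    sumFin n (λ u → d u * t′ u) + sumFin n (λ u → d u * X u)
      ≡⟨ sumFin-distrib-+ n _ _ ⟨
    sumFin n (λ u → d u * t′ u + d u * X u)
      ≡⟨ sumFin-cong n per-vertex ⟩
    sumFin n (λ u → d u * m + d u * t u)
      ≡⟨ sumFin-distrib-+ n _ _ ⟩
    sumFin n (λ u → d u * m) + sumFin n (λ u → d u * t u)
      ≡⟨ cong (_+ sumFin n (λ u → d u * t u)) (*-distribʳ-sumFin n m d) ⟨
    sumFin n d * m + sumFin n (λ u → d u * t u)
      ≡⟨ cong (λ s → s * m + sumFin n (λ u → d u * t u)) handshake ⟩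
    (m + m) * m + sumFin n (λ u → d u * t u) ∎
    where
    d = degree G
    t′ = nonNbrEdges G
    t = triangles G
    X = neighbourDegreeSum
    m = numEdges G
    E = degreeProductSum

    per-vertex : ∀ u → d u * t′ u + d u * X u ≡ d u * m + d u * t u
    per-vertex u = begin
      d u * t′ u + d u * X u  ≡⟨ *-distribˡ-+ (d u) (t′ u) (X u) ⟨
      d u * (t′ u + X u)      ≡⟨ cong (d u *_) (nonNbrEdges+neighbourDegreeSum≡numEdges+triangles u) ⟩
      d u * (m + t u)         ≡⟨ *-distribˡ-+ (d u) m (t u) ⟩
      d u * m + d u * t u     ∎

open import Data.Integer using (ℤ; +_; _+_; _-_; _*_; -_; _⊖_)
open import Data.Integer.Properties
  using ( +-commutativeSemigroup; pos-+; pos-*; neg-distrib-+; neg-distribʳ-*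
        ; *-distribˡ-+; [+m]-[+n]≡m⊖n; +-cancelˡ-⊖ )
open import Algebra.Properties.CommutativeSemigroup +-commutativeSemigroup
  using (interchange)
import Data.Nat.Properties as ℕ
import Data.Integer.Tactic.RingSolver as ℤ-Solver
open ≡-Reasoning

sumFinℤ-cong : ∀ n {f g : Fin n → ℤ} → (∀ i → f i ≡ g i) → sumFinℤ n f ≡ sumFinℤ n g
sumFinℤ-cong zero    f≗g = refl
sumFinℤ-cong (suc n) f≗g = cong₂ _+_ (f≗g zero) (sumFinℤ-cong n (f≗g ∘ suc))

sumFinℤ-pos-difference : ∀ n (f g : Fin n → ℕ) →
  sumFinℤ n (λ i → + f i - + g i) ≡ + sumFin n f - + sumFin n g
sumFinℤ-pos-difference zero    f g = refl
sumFinℤ-pos-difference (suc n) f g = begin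
  (+ f zero - + g zero) + sumFinℤ n (λ i → + f (suc i) - + g (suc i))
    ≡⟨ cong (_+_ (+ f zero - + g zero)) (sumFinℤ-pos-difference n (f ∘ suc) (g ∘ suc)) ⟩
  (+ f zero - + g zero) + (+ F - + G)
    ≡⟨ interchange (+ f zero) (- + g zero) (+ F) (- + G) ⟩
  (+ f zero + + F) + (- + g zero + - + G)
    ≡⟨ cong₂ _+_ (pos-+ (f zero) F)
                 (trans (cong -_ (pos-+ (g zero) G)) (neg-distrib-+ (+ g zero) (+ G))) ⟨
  + (f zero +ℕ F) - + (g zero +ℕ G) ∎
  where
  F = sumFin n (f ∘ suc)
  G = sumFin n (g ∘ suc)

*-distribˡ-- : ∀ x y z → x * (y - z) ≡ x * y - x * z
*-distribˡ-- x y z = trans (*-distribˡ-+ x y (- z)) (cong (_+_ (x * y)) (sym (neg-distribʳ-* x z)))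

pos-difference-≡ : ∀ a b c d → a +ℕ d ≡ c +ℕ b → + a - + b ≡ + c - + d
pos-difference-≡ a b c d a+d≡c+b = begin
  + a - + b              ≡⟨ [+m]-[+n]≡m⊖n a b ⟩
  a ⊖ b                  ≡⟨ +-cancelˡ-⊖ d a b ⟨
  (d +ℕ a) ⊖ (d +ℕ b)    ≡⟨ cong₂ _⊖_ d+a≡b+c (ℕ.+-comm d b) ⟩
  (b +ℕ c) ⊖ (b +ℕ d)    ≡⟨ +-cancelˡ-⊖ b c d ⟩
  c ⊖ d                  ≡⟨ [+m]-[+n]≡m⊖n c d ⟨
  + c - + d              ∎
  where
  d+a≡b+c : d +ℕ a ≡ b +ℕ c
  d+a≡b+c = trans (ℕ.+-comm d a) (trans a+d≡c+b (ℕ.+-comm c b))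

proposition1 : (n : ℕ) (G : Graph n) →
    + 2 * sumFinℤ n (λ u → + degree G u * (+ nonNbrEdges G u - + triangles G u))
      ≡ + 4 * (+ numEdges G * + numEdges G)
        - + 4 * + sumEdges G (λ u v → degree G u *ℕ degree G v)
proposition1 n G = begin
  + 2 * sumFinℤ n (λ u → + d u * (+ t′ u - + t u))
    ≡⟨ cong (+ 2 *_) (sumFinℤ-cong n (λ u → pos-*-distribˡ-- (d u) (t′ u) (t u))) ⟩
  + 2 * sumFinℤ n (λ u → + (d u *ℕ t′ u) - + (d u *ℕ t u))
    ≡⟨ cong (+ 2 *_) (sumFinℤ-pos-difference n _ _) ⟩
  + 2 * (+ sumFin n (λ u → d u *ℕ t′ u) - + sumFin n (λ u → d u *ℕ t u))
    ≡⟨ cong (+ 2 *_) (pos-difference-≡ _ _ ((m +ℕ m) *ℕ m) (E +ℕ E) (degreeWeighted-identity G)) ⟩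
  + 2 * (+ ((m +ℕ m) *ℕ m) - + (E +ℕ E))
    ≡⟨ cong (λ x → + 2 * (x - + (E +ℕ E))) (pos-* (m +ℕ m) m) ⟩
  + 2 * (+ (m +ℕ m) * + m - + (E +ℕ E))
    ≡⟨ cong₂ (λ x y → + 2 * (x * + m - y)) (pos-+ m m) (pos-+ E E) ⟩
  + 2 * ((+ m + + m) * + m - (+ E + + E))
    ≡⟨ ring-identity (+ m) (+ E) ⟩
  + 4 * (+ m * + m) - + 4 * + E ∎
  where
  d = degree G
  t′ = nonNbrEdges G
  t = triangles G
  m = numEdges G
  E = degreeProductSum G

  pos-*-distribˡ-- : ∀ x y z → + x * (+ y - + z) ≡ + (x *ℕ y) - + (x *ℕ z)
  pos-*-distribˡ-- x y z rewrite pos-* x y | pos-* x z = *-distribˡ-- (+ x) (+ y) (+ z)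

  ring-identity : ∀ x y → + 2 * ((x + x) * x - (y + y)) ≡ + 4 * (x * x) - + 4 * y
  ring-identity = ℤ-Solver.solve-∀
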